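{- $n(6,5,20)=42$.
   Context: All graphs are finite, simple (no loops or parallel edges) and connected. For integers $v,k,g,\lambda$, an $egr(v,k,g,\lambda)$ graph (edge-girth-regular graph) is a $k$-regular graph of girth $g$ on $v$ vertices such that every edge is contained in exactly $\lambda$ cycles of length $g$. $n(k,g,\lambda)$ denotes the smallest integer $v$ such that an $egr(v,k,g,\lambda)$ graph exists, and $n(k,g,\lambda)=\infty$ if no such graph exists. -}

module Defs where

open import Data.Nat using (ℕ; zero; suc; _+_; _≤_; _<_)
open import Data.Fin using (Fin; zero; suc)
open import Data.Bool using (Bool; true; false; if_then_else_)
open import Data.Vec using (Vec; []; _∷_; last; toList)
open import Data.List using (List; length)
open import Data.List.Relation.Unary.Unique.Propositional using (Unique)
open import Data.List.Membership.Propositional using (_∈_)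
open import Data.Product using (Σ; _×_; ∃)
open import Data.Unit using (⊤)
open import Data.Empty using (⊥)
open import Function.Bundles using (_⇔_)
open import Relation.Nullary using (¬_)
open import Relation.Binary.PropositionalEquality using (_≡_)

record Graph (n : ℕ) : Set where
  field
    adj    : Fin n → Fin n → Bool
    sym    : ∀ i j → adj i j ≡ adj j i
    irrefl : ∀ i → adj i i ≡ false

module _ {n : ℕ} (G : Graph n) where
  open Graph G

  E : Fin n → Fin n → Set
  E u v = adj u v ≡ true

  countTrue : ∀ {m} → (Fin m → Bool) → ℕ
  countTrue {zero}  f = 0
  countTrue {suc m} f = (if f zero then 1 else 0) + countTrue (λ i → f (suc i))

  degree : Fin n → ℕ
  degree i = countTrue (adj i)

  data Reachable : Fin n → Fin n → Set where
    here : ∀ {i} → Reachable i i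
    step : ∀ {i j k} → E i j → Reachable j k → Reachable i k

  Connected : Set
  Connected = ∀ i j → Reachable i j

  ChainAdj : ∀ {m} → Vec (Fin n) m → Set
  ChainAdj []           = ⊤
  ChainAdj (x ∷ [])     = ⊤
  ChainAdj (x ∷ y ∷ xs) = E x y × ChainAdj (y ∷ xs)

  Closes : ∀ {m} → Vec (Fin n) m → Set
  Closes []       = ⊥
  Closes (x ∷ xs) = E (last (x ∷ xs)) x

  IsCycle : ∀ {m} → Vec (Fin n) m → Set
  IsCycle {m} c = 3 ≤ m × Unique (toList c) × ChainAdj c × Closes c

  HasCycleOfLength : ℕ → Set
  HasCycleOfLength m = Σ (Vec (Fin n) m) IsCycle

  HasGirth : ℕ → Set
  HasGirth g = HasCycleOfLength g × (∀ m → m < g → ¬ HasCycleOfLength m)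

  -- For g ≥ 3 every
  -- g-cycle (as a subgraph) containing the edge uv corresponds to exactly
  -- one such sequence (start at u, traverse the edge uv first).
  StartsWith : ∀ {m} → Fin n → Fin n → Vec (Fin n) m → Set
  StartsWith u v (x ∷ y ∷ _) = x ≡ u × y ≡ v
  StartsWith u v _           = ⊥

  CycleThrough : (g : ℕ) → Fin n → Fin n → Vec (Fin n) g → Set
  CycleThrough g u v c = IsCycle c × StartsWith u v c

HasCount : {A : Set} → ℕ → (A → Set) → Set
HasCount {A} k P =
  Σ (List A) λ l → length l ≡ k × Unique l × (∀ a → (a ∈ l) ⇔ P a)

record IsEGR {v : ℕ} (G : Graph v) (k g lam : ℕ) : Set where
  field
    regular   : ∀ i → degree G i ≡ k
    connected : Connected G
    girth     : HasGirth G g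
    edgeReg   : ∀ u w → E G u w → HasCount lam (CycleThrough G g u w)

NEGR≡ : ℕ → ℕ → ℕ → ℕ → Set
NEGR≡ k g lam v =
  Σ (Graph v) (λ G → IsEGR G k g lam) ×
  (∀ w → w < v → (G : Graph w) → ¬ IsEGR G k g lam)

-- Fix an edge uv of an egr(n,k,5,λ) graph.  Since there are no 3- or 4-cycles, u, its
-- k neighbours N₁ and the k(k−1) further neighbours N₂ of those are pairwise distinct, and so are the
-- (k−1)² vertices Y reached by paths v x y with x ≠ u.  A vertex y ∈ Y ∩ N₂, reached from u via z,
-- closes the 5-cycle u v x y z through uv, whose fourth vertex is y; hence |Y ∩ N₂| ≤ λ, and the
-- remaining vertices of Y are new.  So n ≥ 1 + k² + (k−1)² − λ, which is 42 for k = 6 and λ = 20.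
--
-- The graph G₄₂ is invariant under the rotation v ↦ v + 6 (mod 42), and every orbit
-- of the rotation meets {0,…,5}.  So its girth and the number of 5-cycles through each edge need
-- only be computed at the vertices 0,…,5; they transfer to all vertices along the rotation.
{-# OPTIONS --safe #-}
module Submission where

open import Defs
open import Data.Bool using (Bool; true; false; T)
open import Data.Bool.Properties using () renaming (_≟_ to _≟ᵇ_)
open import Data.Empty using (⊥; ⊥-elim)
open import Data.Fin using (Fin; zero; suc; toℕ; _↑ˡ_; #_)
import Data.Fin.Properties as Fin
open import Data.Fin.Permutation
  using (Permutation′; permutation; _⟨$⟩ʳ_; _⟨$⟩ˡ_; inverseˡ; inverseʳ; flip)
open import Data.List using (List; []; _∷_; length; filter; concatMap; map; _++_; tabulate; allFin; foldr)
open import Data.List.Properties using (≡-dec; length-++; length-++-sucʳ; length-map; length-tabulate)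
open import Data.List.Membership.Propositional using (_∈_; _∉_; find; lose; mapWith∈)
open import Data.List.Membership.Propositional.Properties
  using (∈-allFin; ∈-map⁺; ∈-map⁻; ∈-filter⁺; ∈-filter⁻; ∈-++⁺ˡ; ∈-++⁺ʳ; ∈-++⁻; ∈-∃++;
         ∈-concatMap⁺; ∈-concatMap⁻)
open import Data.List.Relation.Binary.Disjoint.Propositional using (Disjoint)
open import Data.List.Relation.Binary.Subset.Propositional using (_⊆_)
open import Data.List.Relation.Unary.All as All using (All; []; _∷_)
open import Data.List.Relation.Unary.Any using (here; there)
open import Data.List.Relation.Unary.Unique.DecPropositional using (unique?)
open import Data.List.Relation.Unary.Unique.Propositional using (Unique; []; _∷_)
import Data.List.Relation.Unary.Unique.Propositional.Properties as Unique
open import Data.Maybe using (Maybe; just; nothing; _<∣>_; is-just; to-witness-T)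
import Data.Maybe as Maybe
open import Data.Nat using (ℕ; zero; suc; _+_; _*_; _/_; _≤_; _<_; z≤n; s≤s; pred)
open import Data.Nat.DivMod using (_mod_)
import Data.Nat.Properties as ℕ
open import Data.Nat.Properties
  using (<⇒≱; ≤-trans; ≤-reflexive; ≤-antisym; +-suc; *-suc; +-monoˡ-≤; +-monoʳ-≤; module ≤-Reasoning)
open import Data.Nat.Tactic.RingSolver using (solve-∀)
open import Data.Product using (∃; _×_; _,_; proj₁; proj₂)
open import Data.Sum using (_⊎_; inj₁; inj₂)
open import Data.Unit using (tt)
open import Data.Vec using (Vec; []; _∷_)
import Data.Vec as Vec
open import Data.Vec.Properties using (toList-map; map-∘; map-cong; map-id)
open import Function using (_∘_; id; case_of_)
open import Function.Bundles using (_⇔_; mk⇔; Equivalence)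
open import Level using (0ℓ)
open import Relation.Binary.Definitions using (DecidableEquality)
open import Relation.Binary.PropositionalEquality
  using (_≡_; _≢_; refl; sym; trans; cong; cong₂; subst; subst₂; ≢-sym)
open import Relation.Nullary using (¬_; Dec; yes; no; ¬?; does)
open import Relation.Nullary.Decidable
  using (_×-dec_; _⊎-dec_; map′; T?; does-⇔; dec-true; dec-false; toWitness)
open import Relation.Unary using (Pred; Decidable)
open import Relation.Unary.Properties using (∁?)

module _ {A : Set} where

  unique-⊆⇒length≤ : ∀ {xs ys : List A} → Unique xs → xs ⊆ ys → length xs ≤ length ys
  unique-⊆⇒length≤ {[]}          _          _       = z≤n
  unique-⊆⇒length≤ {x ∷ xs} {ys} (x∉ ∷ !xs) x∷xs⊆ys
    with ys₁ , ys₂ , refl ← ∈-∃++ (x∷xs⊆ys (here refl)) =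
    subst (suc (length xs) ≤_) (sym (length-++-sucʳ ys₁ x ys₂)) (s≤s (unique-⊆⇒length≤ !xs xs⊆ys₁++ys₂))
    where
    xs⊆ys₁++ys₂ : xs ⊆ ys₁ ++ ys₂
    xs⊆ys₁++ys₂ {y} y∈xs with ∈-++⁻ ys₁ (x∷xs⊆ys (there y∈xs))
    ... | inj₁ y∈ys₁         = ∈-++⁺ˡ y∈ys₁
    ... | inj₂ (here refl)   = ⊥-elim (All.lookup x∉ y∈xs refl)
    ... | inj₂ (there y∈ys₂) = ∈-++⁺ʳ ys₁ y∈ys₂

  unique-⊆⊇⇒length≡ : ∀ {xs ys : List A} → Unique xs → Unique ys → xs ⊆ ys → ys ⊆ xs →
                      length xs ≡ length ys
  unique-⊆⊇⇒length≡ !xs !ys xs⊆ys ys⊆xs =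
    ≤-antisym (unique-⊆⇒length≤ !xs xs⊆ys) (unique-⊆⇒length≤ !ys ys⊆xs)

  length-filter+length-filter-∁ : ∀ {P : Pred A 0ℓ} (P? : Decidable P) xs →
                                  length (filter P? xs) + length (filter (∁? P?) xs) ≡ length xs
  length-filter+length-filter-∁ P? []       = refl
  length-filter+length-filter-∁ P? (x ∷ xs) with P? x
  ... | yes _ = cong suc (length-filter+length-filter-∁ P? xs)
  ... | no  _ = trans (+-suc _ _) (cong suc (length-filter+length-filter-∁ P? xs))

  unique-concatMap : ∀ {B : Set} (f : A → List B) {xs} → Unique xs → (∀ {x} → x ∈ xs → Unique (f x)) →
                     (∀ {x x′} → x ∈ xs → x′ ∈ xs → x ≢ x′ → Disjoint (f x) (f x′)) →
                     Unique (concatMap f xs)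
  unique-concatMap f {[]}     _          _  _    = []
  unique-concatMap f {x ∷ xs} (x∉ ∷ !xs) !f disj =
    Unique.++⁺ (!f (here refl)) (unique-concatMap f !xs (!f ∘ there) (λ p q → disj (there p) (there q)))
      λ (b∈fx , b∈rest) → let x′ , x′∈xs , b∈fx′ = find (∈-concatMap⁻ f b∈rest)
                          in disj (here refl) (there x′∈xs) (All.lookup x∉ x′∈xs) (b∈fx , b∈fx′)

length-concatMap : ∀ {A B : Set} (f : A → List B) {c} xs → (∀ {x} → x ∈ xs → length (f x) ≡ c) →
                   length (concatMap f xs) ≡ length xs * c
length-concatMap f []       _   = refl
length-concatMap f (x ∷ xs) len =
  trans (length-++ (f x)) (cong₂ _+_ (len (here refl)) (length-concatMap f xs (len ∘ there)))

module _ {A : Set} (_≟_ : DecidableEquality A) where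

  infixl 5 _∖_
  _∖_ : List A → A → List A
  xs ∖ a = filter (∁? (_≟ a)) xs

  ∈-∖⁻ : ∀ {a b xs} → b ∈ xs ∖ a → b ∈ xs × b ≢ a
  ∈-∖⁻ {a} {xs = xs} = ∈-filter⁻ (∁? (_≟ a)) {xs = xs}

  ∖-unique : ∀ {xs} a → Unique xs → Unique (xs ∖ a)
  ∖-unique a = Unique.filter⁺ (∁? (_≟ a))

  length-∖ : ∀ {a xs} → Unique xs → a ∈ xs → suc (length (xs ∖ a)) ≡ length xs
  length-∖ {a} {xs} !xs a∈xs =
    trans (cong (_+ length (xs ∖ a)) (sym one)) (length-filter+length-filter-∁ (_≟ a) xs)
    where
    one : length (filter (_≟ a) xs) ≡ 1
    one = unique-⊆⊇⇒length≡ (Unique.filter⁺ (_≟ a) !xs) ([] ∷ [])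
            (λ b∈ → here (proj₂ (∈-filter⁻ (_≟ a) {xs = xs} b∈)))
            (λ { (here refl) → ∈-filter⁺ (_≟ a) a∈xs refl })

last-map : ∀ {A B : Set} {m} (f : A → B) (xs : Vec A (suc m)) → Vec.last (Vec.map f xs) ≡ f (Vec.last xs)
last-map f (x ∷ [])     = refl
last-map f (x ∷ y ∷ xs) = last-map f (y ∷ xs)

module _ {n : ℕ} (G : Graph n) where
  open Graph G renaming (sym to adj-sym)

  E? : ∀ i j → Dec (E G i j)
  E? i j = adj i j ≟ᵇ true

  E-sym : ∀ {i j} → E G i j → E G j i
  E-sym {i} {j} = trans (adj-sym j i)

  E⇒≢ : ∀ {i j} → E G i j → i ≢ j
  E⇒≢ {i} e refl with () ← trans (sym e) (irrefl i)

  Reachable-trans : ∀ {i j k} → Reachable G i j → Reachable G j k → Reachable G i k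
  Reachable-trans here        r = r
  Reachable-trans (step e r′) r = step e (Reachable-trans r′ r)

  Reachable-sym : ∀ {i j} → Reachable G i j → Reachable G j i
  Reachable-sym here       = here
  Reachable-sym (step e r) = Reachable-trans (Reachable-sym r) (step (E-sym e) here)

  connected-via : ∀ r → (∀ i → Reachable G i r) → Connected G
  connected-via r reach i j = Reachable-trans (reach i) (Reachable-sym (reach j))

  length-filter-tabulate : ∀ {A : Set} {m} (f : A → Bool) (h : Fin m → A) →
                           length (filter (λ a → f a ≟ᵇ true) (tabulate h)) ≡ countTrue G (f ∘ h)
  length-filter-tabulate {m = zero}  f h = refl
  length-filter-tabulate {m = suc m} f h with f (h zero)
  ... | true  = cong suc (length-filter-tabulate f (h ∘ suc))
  ... | false = length-filter-tabulate f (h ∘ suc)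

record AdjacencyList {n : ℕ} (G : Graph n) : Set where
  field
    nbrs          : Fin n → List (Fin n)
    nbrs-unique   : ∀ i → Unique (nbrs i)
    nbrs-sound    : ∀ {i j} → j ∈ nbrs i → E G i j
    nbrs-complete : ∀ {i j} → E G i j → j ∈ nbrs i

filterAdjacencyList : ∀ {n} (G : Graph n) → AdjacencyList G
filterAdjacencyList {n} G = record
  { nbrs          = λ i → filter (E? G i) (allFin n)
  ; nbrs-unique   = λ i → Unique.filter⁺ (E? G i) (Unique.allFin⁺ n)
  ; nbrs-sound    = λ {i} j∈ → proj₂ (∈-filter⁻ (E? G i) {xs = allFin n} j∈)
  ; nbrs-complete = λ {i} {j} e → ∈-filter⁺ (E? G i) (∈-allFin j) e
  }

length-nbrs : ∀ {n} {G : Graph n} (L : AdjacencyList G) i → length (AdjacencyList.nbrs L i) ≡ degree G i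
length-nbrs {n} {G} L i = trans
  (unique-⊆⊇⇒length≡ (nbrs-unique i) (F.nbrs-unique i)
    (F.nbrs-complete ∘ nbrs-sound) (nbrs-complete ∘ F.nbrs-sound))
  (length-filter-tabulate G (Graph.adj G i) id)
  where
  open AdjacencyList L
  module F = AdjacencyList (filterAdjacencyList G)

module _ {n : ℕ} (nbrs : Fin n → List (Fin n))
         (symm : ∀ {i j} → j ∈ nbrs i → i ∈ nbrs j) (loopless : ∀ i → i ∉ nbrs i) where
  open import Data.List.Membership.DecPropositional (Fin._≟_ {n}) using (_∈?_)

  listGraph : Graph n
  listGraph = record
    { adj    = λ i j → does (j ∈? nbrs i)
    ; sym    = λ i j → does-⇔ (mk⇔ (symm {i}) (symm {j})) (j ∈? nbrs i) (i ∈? nbrs j)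
    ; irrefl = λ i → dec-false (i ∈? nbrs i) (loopless i)
    }

  listAdjacencyList : (∀ i → Unique (nbrs i)) → AdjacencyList listGraph
  listAdjacencyList unique = record
    { nbrs          = nbrs
    ; nbrs-unique   = unique
    ; nbrs-sound    = λ {i} {j} → dec-true (j ∈? nbrs i)
    ; nbrs-complete = adjacent⇒∈
    }
    where
    adjacent⇒∈ : ∀ {i j} → does (j ∈? nbrs i) ≡ true → j ∈ nbrs i
    adjacent⇒∈ {i} {j} e with j ∈? nbrs i
    ... | yes j∈ = j∈
    ... | no  _  with () ← e

module _ {n : ℕ} (G : Graph n) where

  TriangleFreeAt : Fin n → Set
  TriangleFreeAt a = ∀ {b c} → E G a b → E G b c → E G c a → ⊥

  SquareFreeAt : Fin n → Set
  SquareFreeAt a = ∀ {b c d} → E G a b → E G b c → E G c d → E G d a → a ≢ c → b ≢ d → ⊥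

  triangle⇒cycle : ∀ {a b c} → E G a b → E G b c → E G c a → IsCycle G (a ∷ b ∷ c ∷ [])
  triangle⇒cycle eab ebc eca =
    s≤s (s≤s (s≤s z≤n)) ,
    ((E⇒≢ G eab ∷ ≢-sym (E⇒≢ G eca) ∷ []) ∷ (E⇒≢ G ebc ∷ []) ∷ [] ∷ []) ,
    (eab , ebc , tt) , eca

  square⇒cycle : ∀ {a b c d} → E G a b → E G b c → E G c d → E G d a → a ≢ c → b ≢ d →
                 IsCycle G (a ∷ b ∷ c ∷ d ∷ [])
  square⇒cycle eab ebc ecd eda a≢c b≢d =
    s≤s (s≤s (s≤s z≤n)) ,
    ((E⇒≢ G eab ∷ a≢c ∷ ≢-sym (E⇒≢ G eda) ∷ []) ∷ (E⇒≢ G ebc ∷ b≢d ∷ []) ∷ (E⇒≢ G ecd ∷ []) ∷ [] ∷ []) ,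
    (eab , ebc , ecd , tt) , eda

  girth5⇒triangleFree : HasGirth G 5 → ∀ a → TriangleFreeAt a
  girth5⇒triangleFree (_ , noShort) a eab ebc eca =
    noShort 3 (s≤s (s≤s (s≤s (s≤s z≤n)))) (_ , triangle⇒cycle eab ebc eca)

  girth5⇒squareFree : HasGirth G 5 → ∀ a → SquareFreeAt a
  girth5⇒squareFree (_ , noShort) a eab ebc ecd eda a≢c b≢d =
    noShort 4 (s≤s (s≤s (s≤s (s≤s (s≤s z≤n))))) (_ , square⇒cycle eab ebc ecd eda a≢c b≢d)

  girth5 : HasCycleOfLength G 5 → (∀ a → TriangleFreeAt a) → (∀ a → SquareFreeAt a) → HasGirth G 5
  girth5 pentagon triangleFree squareFree = pentagon , noShort
    where
    noShort : ∀ m → m < 5 → ¬ HasCycleOfLength G m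
    noShort 0 _ (_ , () , _)
    noShort 1 _ (_ , s≤s () , _)
    noShort 2 _ (_ , s≤s (s≤s ()) , _)
    noShort 3 _ (a ∷ b ∷ c ∷ [] , _ , _ , (eab , ebc , _) , eca) = triangleFree a eab ebc eca
    noShort 4 _ (a ∷ b ∷ c ∷ d ∷ [] , _ , ((_ ∷ a≢c ∷ _) ∷ (_ ∷ b≢d ∷ _) ∷ _) , (eab , ebc , ecd , _) , eda) =
      squareFree a eab ebc ecd eda a≢c b≢d
    noShort (suc (suc (suc (suc (suc _))))) (s≤s (s≤s (s≤s (s≤s (s≤s ()))))) _

  -- Any two vertices of a closed walk of length 5 are consecutive or two apart on it, so the walk is
  -- a cycle iff the vertices two apart are distinct.
  DistinctDiagonals : Vec (Fin n) 5 → Set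
  DistinctDiagonals (a ∷ b ∷ c ∷ d ∷ e ∷ []) = a ≢ c × b ≢ d × c ≢ e × d ≢ a × e ≢ b

  isCycle⇔pentagon : ∀ (v : Vec (Fin n) 5) →
                     IsCycle G v ⇔ (ChainAdj G v × Closes G v × DistinctDiagonals v)
  isCycle⇔pentagon (a ∷ b ∷ c ∷ d ∷ e ∷ []) = mk⇔ to from
    where
    v : Vec (Fin n) 5
    v = a ∷ b ∷ c ∷ d ∷ e ∷ []
    to : IsCycle G v → ChainAdj G v × Closes G v × DistinctDiagonals v
    to (_ , ((_ ∷ a≢c ∷ a≢d ∷ _) ∷ (_ ∷ b≢d ∷ b≢e ∷ []) ∷ (_ ∷ c≢e ∷ []) ∷ _) , chain , eea) =
      chain , eea , a≢c , b≢d , c≢e , ≢-sym a≢d , ≢-sym b≢e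
    from : ChainAdj G v × Closes G v × DistinctDiagonals v → IsCycle G v
    from (chain@(eab , ebc , ecd , ede , _) , eea , a≢c , b≢d , c≢e , d≢a , e≢b) =
      s≤s (s≤s (s≤s z≤n)) ,
      ((E⇒≢ G eab ∷ a≢c ∷ ≢-sym d≢a ∷ ≢-sym (E⇒≢ G eea) ∷ []) ∷ (E⇒≢ G ebc ∷ b≢d ∷ ≢-sym e≢b ∷ []) ∷
       (E⇒≢ G ecd ∷ c≢e ∷ []) ∷ (E⇒≢ G ede ∷ []) ∷ [] ∷ []) ,
      chain , eea

-- The lower bound

module _ {n k lam : ℕ} {G : Graph n} (egr : IsEGR G k 5 lam) where
  open IsEGR egr
  open AdjacencyList (filterAdjacencyList G)
  open import Data.List.Membership.DecPropositional (Fin._≟_ {n}) using (_∈?_)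

  private
    triangleFree : ∀ a → TriangleFreeAt G a
    triangleFree = girth5⇒triangleFree G girth

    squareFree : ∀ a → SquareFreeAt G a
    squareFree = girth5⇒squareFree G girth

    length-nbrs≡k : ∀ i → length (nbrs i) ≡ k
    length-nbrs≡k i = trans (length-nbrs (filterAdjacencyList G) i) (regular i)

    nbrs-except : Fin n → Fin n → List (Fin n)
    nbrs-except i a = _∖_ Fin._≟_ (nbrs i) a

    ∈nbrs-except⁻ : ∀ {i a b} → b ∈ nbrs-except i a → E G i b × b ≢ a
    ∈nbrs-except⁻ {i} {a} b∈ with b∈nbrs , b≢a ← ∈-∖⁻ Fin._≟_ {a} {xs = nbrs i} b∈ =
      nbrs-sound b∈nbrs , b≢a

    nbrs-except-unique : ∀ i a → Unique (nbrs-except i a)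
    nbrs-except-unique i a = ∖-unique Fin._≟_ a (nbrs-unique i)

    length-nbrs-except : ∀ {i a} → E G i a → length (nbrs-except i a) ≡ pred k
    length-nbrs-except {i} e =
      cong pred (trans (length-∖ Fin._≟_ (nbrs-unique i) (nbrs-complete e)) (length-nbrs≡k i))

  module AtEdge {u v} (euv : E G u v) where
    N₁ N₂ Y Y∩N₂ Y∖N₂ counted : List (Fin n)
    N₁      = nbrs u
    N₂      = concatMap (λ z → nbrs-except z u) N₁
    Y       = concatMap (λ x → nbrs-except x v) (nbrs-except v u)
    Y∩N₂    = filter (_∈? N₂) Y
    Y∖N₂    = filter (∁? (_∈? N₂)) Y
    counted = u ∷ N₁ ++ N₂ ++ Y∖N₂

    ∈N₂⁻ : ∀ {a} → a ∈ N₂ → ∃ λ z → E G u z × E G z a × a ≢ u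
    ∈N₂⁻ a∈ with z , z∈ , a∈′ ← find (∈-concatMap⁻ (λ z → nbrs-except z u) {xs = N₁} a∈)
            with eza , a≢u ← ∈nbrs-except⁻ a∈′ = z , nbrs-sound z∈ , eza , a≢u

    ∈Y⁻ : ∀ {a} → a ∈ Y → ∃ λ x → E G v x × x ≢ u × E G x a × a ≢ v
    ∈Y⁻ a∈ with x , x∈ , a∈′ ← find (∈-concatMap⁻ (λ x → nbrs-except x v) {xs = nbrs-except v u} a∈)
           with evx , x≢u ← ∈nbrs-except⁻ x∈
           with exa , a≢v ← ∈nbrs-except⁻ a∈′ = x , evx , x≢u , exa , a≢v

    ∈Y∖N₂⁻ : ∀ {a} → a ∈ Y∖N₂ → a ∈ Y × a ∉ N₂
    ∈Y∖N₂⁻ = ∈-filter⁻ (∁? (_∈? N₂)) {xs = Y}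

    length-N₂ : length N₂ ≡ k * pred k
    length-N₂ = trans (length-concatMap (λ z → nbrs-except z u) N₁
                         (λ z∈ → length-nbrs-except (E-sym G (nbrs-sound z∈))))
                      (cong (_* pred k) (length-nbrs≡k u))

    length-Y : length Y ≡ pred k * pred k
    length-Y = trans (length-concatMap (λ x → nbrs-except x v) (nbrs-except v u)
                        (λ x∈ → length-nbrs-except (E-sym G (proj₁ (∈nbrs-except⁻ x∈)))))
                     (cong (_* pred k) (length-nbrs-except (E-sym G euv)))

    N₂-unique : Unique N₂
    N₂-unique = unique-concatMap (λ z → nbrs-except z u) (nbrs-unique u)
                  (λ {z} _ → nbrs-except-unique z u)
      λ z∈ z′∈ z≢z′ (a∈ , a∈′) →
        let eza , a≢u = ∈nbrs-except⁻ a∈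
            ez′a , _  = ∈nbrs-except⁻ a∈′
        in squareFree u (nbrs-sound z∈) eza (E-sym G ez′a) (E-sym G (nbrs-sound z′∈)) (≢-sym a≢u) z≢z′

    Y-unique : Unique Y
    Y-unique = unique-concatMap (λ x → nbrs-except x v) (nbrs-except-unique v u)
                 (λ {x} _ → nbrs-except-unique x v)
      λ x∈ x′∈ x≢x′ (a∈ , a∈′) →
        let exa , a≢v = ∈nbrs-except⁻ a∈
            ex′a , _  = ∈nbrs-except⁻ a∈′
            evx , _   = ∈nbrs-except⁻ x∈
            evx′ , _  = ∈nbrs-except⁻ x′∈
        in squareFree v evx exa (E-sym G ex′a) (E-sym G evx′) (≢-sym a≢v) x≢x′

    counted-unique : Unique counted
    counted-unique = All.tabulate u∉ ∷ Unique.++⁺ (nbrs-unique u) N₂++Y∖N₂-unique N₁#N₂++Y∖N₂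
      where
      u∉ : ∀ {a} → a ∈ N₁ ++ N₂ ++ Y∖N₂ → u ≢ a
      u∉ a∈ with ∈-++⁻ N₁ a∈
      ... | inj₁ a∈N₁ = E⇒≢ G (nbrs-sound a∈N₁)
      ... | inj₂ a∈′ with ∈-++⁻ N₂ a∈′
      ... | inj₁ a∈N₂ = ≢-sym (proj₂ (proj₂ (proj₂ (∈N₂⁻ a∈N₂))))
      ... | inj₂ a∈Y∖N₂ with x , evx , _ , exa , _ ← ∈Y⁻ (proj₁ (∈Y∖N₂⁻ a∈Y∖N₂)) =
        λ { refl → triangleFree u euv evx exa }
      N₂++Y∖N₂-unique : Unique (N₂ ++ Y∖N₂)
      N₂++Y∖N₂-unique = Unique.++⁺ N₂-unique (Unique.filter⁺ (∁? (_∈? N₂)) Y-unique)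
                          λ (a∈N₂ , a∈Y∖N₂) → proj₂ (∈Y∖N₂⁻ a∈Y∖N₂) a∈N₂
      N₁#N₂++Y∖N₂ : Disjoint N₁ (N₂ ++ Y∖N₂)
      N₁#N₂++Y∖N₂ (a∈N₁ , a∈′) with ∈-++⁻ N₂ a∈′
      ... | inj₁ a∈N₂ with z , euz , eza , _ ← ∈N₂⁻ a∈N₂ =
        triangleFree u euz eza (E-sym G (nbrs-sound a∈N₁))
      ... | inj₂ a∈Y∖N₂ with x , evx , x≢u , exa , a≢v ← ∈Y⁻ (proj₁ (∈Y∖N₂⁻ a∈Y∖N₂)) =
        squareFree u euv evx exa (E-sym G (nbrs-sound a∈N₁)) (≢-sym x≢u) (≢-sym a≢v)

    cycles : List (Vec (Fin n) 5)
    cycles = proj₁ (edgeReg u v euv)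

    length-cycles : length cycles ≡ lam
    length-cycles = proj₁ (proj₂ (edgeReg u v euv))

    cycles-complete : ∀ {c} → CycleThrough G 5 u v c → c ∈ cycles
    cycles-complete {c} = Equivalence.from (proj₂ (proj₂ (proj₂ (edgeReg u v euv))) c)

    fourth : Vec (Fin n) 5 → Fin n
    fourth (_ ∷ _ ∷ _ ∷ y ∷ _ ∷ []) = y

    Y∩N₂⊆fourths : Y∩N₂ ⊆ map fourth cycles
    Y∩N₂⊆fourths {y} y∈
      with y∈Y , y∈N₂ ← ∈-filter⁻ (_∈? N₂) {xs = Y} y∈
      with x , evx , x≢u , exy , y≢v ← ∈Y⁻ y∈Y
      with z , euz , ezy , y≢u ← ∈N₂⁻ y∈N₂
      = ∈-map⁺ fourth (cycles-complete (pentagon , refl , refl))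
      where
      pentagon : IsCycle G (u ∷ v ∷ x ∷ y ∷ z ∷ [])
      pentagon = Equivalence.from (isCycle⇔pentagon G _)
        ( (euv , evx , exy , E-sym G ezy , tt) , E-sym G euz
        , ≢-sym x≢u , ≢-sym y≢v
        , (λ { refl → triangleFree u euv evx (E-sym G euz) })
        , y≢u
        , (λ { refl → triangleFree v evx exy (E-sym G ezy) }) )

    Y∩N₂-bound : length Y∩N₂ ≤ lam
    Y∩N₂-bound = ≤-trans (unique-⊆⇒length≤ (Unique.filter⁺ (_∈? N₂) Y-unique) Y∩N₂⊆fourths)
                         (≤-reflexive (trans (length-map fourth cycles) length-cycles))

    counted-bound : length counted ≤ n
    counted-bound = ≤-trans (unique-⊆⇒length≤ counted-unique (λ {a} _ → ∈-allFin a))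
                            (≤-reflexive (length-tabulate id))

    length-counted : length counted ≡ suc (k + (k * pred k + length Y∖N₂))
    length-counted = cong suc (trans (length-++ N₁) (cong₂ _+_ (length-nbrs≡k u)
                       (trans (length-++ N₂) (cong (_+ length Y∖N₂) length-N₂))))

    bound : suc (k * k + pred k * pred k) ≤ n + lam
    bound = begin
      suc (k * k + pred k * pred k)
        ≡⟨ cong₂ (λ s t → suc (s + t)) (square-pred k) (sym Y-split) ⟩
      suc ((k + k * pred k) + (length Y∩N₂ + length Y∖N₂))
        ≤⟨ s≤s (+-monoʳ-≤ (k + k * pred k) (+-monoˡ-≤ (length Y∖N₂) Y∩N₂-bound)) ⟩
      suc ((k + k * pred k) + (lam + length Y∖N₂))
        ≡⟨ cong suc (rearrange k (k * pred k) lam (length Y∖N₂)) ⟩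
      suc (k + (k * pred k + length Y∖N₂)) + lam
        ≡⟨ cong (_+ lam) (sym length-counted) ⟩
      length counted + lam
        ≤⟨ +-monoˡ-≤ lam counted-bound ⟩
      n + lam ∎
      where
      open ≤-Reasoning
      Y-split : length Y∩N₂ + length Y∖N₂ ≡ pred k * pred k
      Y-split = trans (length-filter+length-filter-∁ (_∈? N₂) Y) length-Y
      square-pred : ∀ m → m * m ≡ m + m * pred m
      square-pred zero    = refl
      square-pred (suc m) = *-suc (suc m) m
      rearrange : ∀ a b c d → (a + b) + (c + d) ≡ a + (b + d) + c
      rearrange = solve-∀

  girth5-order-bound : suc (k * k + pred k * pred k) ≤ n + lam
  girth5-order-bound with (_ ∷ _ ∷ _) , _ , _ , (euv , _) , _ ← proj₁ girth = AtEdge.bound euv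

-- Deciding local properties from adjacency lists

module FiveCycles {n : ℕ} {G : Graph n} (L : AdjacencyList G) where
  open AdjacencyList L

  walksFrom : Fin n → Fin n → List (Vec (Fin n) 5)
  walksFrom u w =
    concatMap (λ x → concatMap (λ y → map (λ z → u ∷ w ∷ x ∷ y ∷ z ∷ []) (nbrs y)) (nbrs x)) (nbrs w)

  ∈walksFrom⁺ : ∀ {u w x y z} → E G w x → E G x y → E G y z → u ∷ w ∷ x ∷ y ∷ z ∷ [] ∈ walksFrom u w
  ∈walksFrom⁺ ewx exy eyz =
    ∈-concatMap⁺ _ (lose (nbrs-complete ewx)
      (∈-concatMap⁺ _ (lose (nbrs-complete exy) (∈-map⁺ _ (nbrs-complete eyz)))))

  ∈walksFrom⁻ : ∀ {u w a b x y z} → a ∷ b ∷ x ∷ y ∷ z ∷ [] ∈ walksFrom u w →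
                a ≡ u × b ≡ w × ChainAdj G (b ∷ x ∷ y ∷ z ∷ [])
  ∈walksFrom⁻ {u} {w} v∈
    with x , x∈ , v∈₁ ← find (∈-concatMap⁻ _ {xs = nbrs w} v∈)
    with y , y∈ , v∈₂ ← find (∈-concatMap⁻ _ {xs = nbrs x} v∈₁)
    with z , z∈ , refl ← ∈-map⁻ _ v∈₂
    = refl , refl , nbrs-sound x∈ , nbrs-sound y∈ , nbrs-sound z∈ , tt

  walksFrom-unique : ∀ u w → Unique (walksFrom u w)
  walksFrom-unique u w =
    unique-concatMap _ (nbrs-unique w)
      (λ {x} _ → unique-concatMap _ (nbrs-unique x)
        (λ {y} _ → Unique.map⁺ {f = λ z → u ∷ w ∷ x ∷ y ∷ z ∷ []} last-injective (nbrs-unique y))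
        λ _ _ y≢y′ (v∈ , v∈′) → y≢y′ (trans (sym (fourth∈ v∈)) (fourth∈ v∈′)))
      λ _ _ x≢x′ (v∈ , v∈′) → x≢x′ (trans (sym (third∈ v∈)) (third∈ v∈′))
    where
    last-injective : ∀ {x y z z′} →
                     _≡_ {A = Vec (Fin n) 5} (u ∷ w ∷ x ∷ y ∷ z ∷ []) (u ∷ w ∷ x ∷ y ∷ z′ ∷ []) → z ≡ z′
    last-injective refl = refl
    third fourth : Vec (Fin n) 5 → Fin n
    third  (_ ∷ _ ∷ x ∷ _ ∷ _ ∷ []) = x
    fourth (_ ∷ _ ∷ _ ∷ y ∷ _ ∷ []) = y
    fourth∈ : ∀ {x y v} → v ∈ map (λ z → u ∷ w ∷ x ∷ y ∷ z ∷ []) (nbrs y) → fourth v ≡ y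
    fourth∈ v∈ with _ , _ , refl ← ∈-map⁻ _ v∈ = refl
    third∈ : ∀ {x v} → v ∈ concatMap (λ y → map (λ z → u ∷ w ∷ x ∷ y ∷ z ∷ []) (nbrs y)) (nbrs x) →
             third v ≡ x
    third∈ {x} v∈ with y , _ , v∈′ ← find (∈-concatMap⁻ _ {xs = nbrs x} v∈)
                  with _ , _ , refl ← ∈-map⁻ _ v∈′ = refl

  -- The closing edge is tested first because it rejects most walks cheaply.
  closes? : ∀ (v : Vec (Fin n) 5) → Dec (Closes G v × DistinctDiagonals G v)
  closes? (a ∷ b ∷ c ∷ d ∷ e ∷ []) =
    E? G e a ×-dec ¬? (a Fin.≟ c) ×-dec ¬? (b Fin.≟ d) ×-dec ¬? (c Fin.≟ e) ×-dec ¬? (d Fin.≟ a)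
             ×-dec ¬? (e Fin.≟ b)

  fiveCyclesThrough : Fin n → Fin n → List (Vec (Fin n) 5)
  fiveCyclesThrough u w = filter closes? (walksFrom u w)

  ∈fiveCyclesThrough⇔ : ∀ {u w} → E G u w → ∀ v → v ∈ fiveCyclesThrough u w ⇔ CycleThrough G 5 u w v
  ∈fiveCyclesThrough⇔ {u} {w} euw v@(a ∷ b ∷ x ∷ y ∷ z ∷ []) = mk⇔ to from
    where
    to : v ∈ fiveCyclesThrough u w → CycleThrough G 5 u w v
    to v∈ with v∈walks , closing , diagonals ← ∈-filter⁻ closes? {xs = walksFrom u w} v∈
          with refl , refl , chain ← ∈walksFrom⁻ v∈walks
      = Equivalence.from (isCycle⇔pentagon G v) ((euw , chain) , closing , diagonals) , refl , refl
    from : CycleThrough G 5 u w v → v ∈ fiveCyclesThrough u w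
    from (cycle , refl , refl)
      with (_ , ewx , exy , eyz , _) , closing , diagonals ← Equivalence.to (isCycle⇔pentagon G v) cycle
      = ∈-filter⁺ closes? (∈walksFrom⁺ ewx exy eyz) (closing , diagonals)

  fiveCycleCount : ∀ {u w} → E G u w → HasCount (length (fiveCyclesThrough u w)) (CycleThrough G 5 u w)
  fiveCycleCount {u} {w} euw =
    fiveCyclesThrough u w , refl , Unique.filter⁺ closes? (walksFrom-unique u w) , ∈fiveCyclesThrough⇔ euw

module _ {n : ℕ} {G : Graph n} (L : AdjacencyList G) where
  open AdjacencyList L

  triangleFreeAt? : ∀ a → Dec (TriangleFreeAt G a)
  triangleFreeAt? a = map′ from to (All.all? (λ b → All.all? (λ c → ¬? (E? G c a)) (nbrs b)) (nbrs a))
    where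
    NoTriangle : Set
    NoTriangle = All (λ b → All (λ c → ¬ E G c a) (nbrs b)) (nbrs a)
    from : NoTriangle → TriangleFreeAt G a
    from none eab ebc = All.lookup (All.lookup none (nbrs-complete eab)) (nbrs-complete ebc)
    to : TriangleFreeAt G a → NoTriangle
    to free = All.tabulate λ b∈ → All.tabulate λ c∈ → free (nbrs-sound b∈) (nbrs-sound c∈)

  squareFreeAt? : ∀ a → Dec (SquareFreeAt G a)
  squareFreeAt? a =
    map′ from to (All.all? (λ b → All.all? (λ c → c Fin.≟ a ⊎-dec
                    All.all? (λ d → d Fin.≟ b ⊎-dec ¬? (E? G d a)) (nbrs c)) (nbrs b)) (nbrs a))
    where
    NoSquare : Set
    NoSquare = All (λ b → All (λ c → c ≡ a ⊎ All (λ d → d ≡ b ⊎ ¬ E G d a) (nbrs c)) (nbrs b)) (nbrs a)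
    from : NoSquare → SquareFreeAt G a
    from none eab ebc ecd eda a≢c b≢d
      with All.lookup (All.lookup none (nbrs-complete eab)) (nbrs-complete ebc)
    ... | inj₁ c≡a  = a≢c (sym c≡a)
    ... | inj₂ none′ with All.lookup none′ (nbrs-complete ecd)
    ...   | inj₁ d≡b  = b≢d (sym d≡b)
    ...   | inj₂ ¬eda = ¬eda eda
    to : SquareFreeAt G a → NoSquare
    to free = All.tabulate λ {b} b∈ → All.tabulate λ {c} c∈ → case c Fin.≟ a of λ where
      (yes c≡a) → inj₁ c≡a
      (no c≢a)  → inj₂ (All.tabulate λ {d} d∈ → case d Fin.≟ b of λ where
        (yes d≡b) → inj₁ d≡b
        (no d≢b)  → inj₂ λ eda →
          free (nbrs-sound b∈) (nbrs-sound c∈) (nbrs-sound d∈) eda (≢-sym c≢a) (≢-sym d≢b))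

  findPath : ℕ → ∀ i j → Maybe (Reachable G i j)
  findPath fuel i j with i Fin.≟ j
  ... | yes refl = just here
  findPath zero       i j | no _ = nothing
  findPath (suc fuel) i j | no _ =
    foldr _<∣>_ nothing (mapWith∈ (nbrs i) λ x∈ → Maybe.map (step (nbrs-sound x∈)) (findPath fuel _ j))

-- Automorphisms

record Automorphism {n : ℕ} (G : Graph n) : Set where
  field
    perm      : Permutation′ n
    preserves : ∀ i j → Graph.adj G (perm ⟨$⟩ʳ i) (perm ⟨$⟩ʳ j) ≡ Graph.adj G i j

module _ {n : ℕ} {G : Graph n} where
  open Automorphism

  infix 8 _·_
  _·_ : Automorphism G → Fin n → Fin n
  σ · i = perm σ ⟨$⟩ʳ i

  _⁻¹ : Automorphism G → Automorphism G
  σ ⁻¹ = record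
    { perm      = flip (perm σ)
    ; preserves = λ i j → trans (sym (preserves σ _ _))
                                (cong₂ (Graph.adj G) (inverseʳ (perm σ)) (inverseʳ (perm σ)))
    }

  module _ (σ : Automorphism G) where

    ⁻¹·· : ∀ i → σ ⁻¹ · (σ · i) ≡ i
    ⁻¹·· i = inverseˡ (perm σ)

    ··⁻¹ : ∀ i → σ · (σ ⁻¹ · i) ≡ i
    ··⁻¹ i = inverseʳ (perm σ)

    ·-injective : ∀ {i j} → σ · i ≡ σ · j → i ≡ j
    ·-injective {i} {j} eq = trans (sym (⁻¹·· i)) (trans (cong (σ ⁻¹ ·_) eq) (⁻¹·· j))

    E-preserved : ∀ {i j} → E G i j → E G (σ · i) (σ · j)
    E-preserved {i} {j} = trans (preserves σ i j)

    ChainAdj-preserved : ∀ {m} (c : Vec (Fin n) m) → ChainAdj G c → ChainAdj G (Vec.map (σ ·_) c)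
    ChainAdj-preserved []          _           = tt
    ChainAdj-preserved (_ ∷ [])    _           = tt
    ChainAdj-preserved (_ ∷ y ∷ c) (e , chain) = E-preserved e , ChainAdj-preserved (y ∷ c) chain

    Closes-preserved : ∀ {m} (c : Vec (Fin n) m) → Closes G c → Closes G (Vec.map (σ ·_) c)
    Closes-preserved (x ∷ c) e = subst (λ y → E G y (σ · x)) (sym (last-map (σ ·_) (x ∷ c))) (E-preserved e)

    IsCycle-preserved : ∀ {m} (c : Vec (Fin n) m) → IsCycle G c → IsCycle G (Vec.map (σ ·_) c)
    IsCycle-preserved c (3≤m , unique , chain , closes) =
      3≤m , subst Unique (sym (toList-map (σ ·_) c)) (Unique.map⁺ ·-injective unique) ,
      ChainAdj-preserved c chain , Closes-preserved c closes

    CycleThrough-preserved : ∀ {g u w} (c : Vec (Fin n) g) → CycleThrough G g u w c →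
                             CycleThrough G g (σ · u) (σ · w) (Vec.map (σ ·_) c)
    CycleThrough-preserved c@(_ ∷ _ ∷ _) (cycle , refl , refl) = IsCycle-preserved c cycle , refl , refl

    Reachable-preserved : ∀ {i j} → Reachable G i j → Reachable G (σ · i) (σ · j)
    Reachable-preserved here       = here
    Reachable-preserved (step e r) = step (E-preserved e) (Reachable-preserved r)

    map-·-⁻¹ : ∀ {m} (c : Vec (Fin n) m) → Vec.map (σ ·_) (Vec.map (σ ⁻¹ ·_) c) ≡ c
    map-·-⁻¹ c = trans (sym (map-∘ (σ ·_) (σ ⁻¹ ·_) c)) (trans (map-cong ··⁻¹ c) (map-id c))

    map-⁻¹-· : ∀ {m} (c : Vec (Fin n) m) → Vec.map (σ ⁻¹ ·_) (Vec.map (σ ·_) c) ≡ c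
    map-⁻¹-· c = trans (sym (map-∘ (σ ⁻¹ ·_) (σ ·_) c)) (trans (map-cong ⁻¹·· c) (map-id c))

    map-·-injective : ∀ {m} {c c′ : Vec (Fin n) m} → Vec.map (σ ·_) c ≡ Vec.map (σ ·_) c′ → c ≡ c′
    map-·-injective {c = c} {c′} eq =
      trans (sym (map-⁻¹-· c)) (trans (cong (Vec.map (σ ⁻¹ ·_)) eq) (map-⁻¹-· c′))

  module _ (σ : Automorphism G) where

    E-pulled-back : ∀ {a b} → E G (σ · a) b → E G a (σ ⁻¹ · b)
    E-pulled-back {a} e = subst (λ x → E G x _) (⁻¹·· σ a) (E-preserved (σ ⁻¹) e)

    cycleCount-preserved : ∀ {g k u w} → HasCount k (CycleThrough G g u w) →
                           HasCount k (CycleThrough G g (σ · u) (σ · w))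
    cycleCount-preserved {g} {k} {u} {w} (l , len , unique , ∈l⇔) =
      map (Vec.map (σ ·_)) l , trans (length-map _ l) len , Unique.map⁺ (map-·-injective σ) unique ,
      λ c → mk⇔ (to c) (from c)
      where
      to : ∀ c → c ∈ map (Vec.map (σ ·_)) l → CycleThrough G g (σ · u) (σ · w) c
      to c c∈ with d , d∈ , refl ← ∈-map⁻ _ c∈ = CycleThrough-preserved σ d (Equivalence.to (∈l⇔ d) d∈)
      from : ∀ c → CycleThrough G g (σ · u) (σ · w) c → c ∈ map (Vec.map (σ ·_)) l
      from c through =
        subst (_∈ map (Vec.map (σ ·_)) l) (map-·-⁻¹ σ c) (∈-map⁺ _ (Equivalence.from (∈l⇔ _)
          (subst₂ (λ a b → CycleThrough G g a b _) (⁻¹·· σ u) (⁻¹·· σ w)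
            (CycleThrough-preserved (σ ⁻¹) c through))))

    TriangleFreeAt-preserved : ∀ {a} → TriangleFreeAt G a → TriangleFreeAt G (σ · a)
    TriangleFreeAt-preserved free eab ebc eca =
      free (E-pulled-back eab) (E-preserved (σ ⁻¹) ebc) (E-sym G (E-pulled-back (E-sym G eca)))

    SquareFreeAt-preserved : ∀ {a} → SquareFreeAt G a → SquareFreeAt G (σ · a)
    SquareFreeAt-preserved free {b} {c} {d} eab ebc ecd eda a≢c b≢d =
      free (E-pulled-back eab) (E-preserved (σ ⁻¹) ebc) (E-preserved (σ ⁻¹) ecd)
           (E-sym G (E-pulled-back (E-sym G eda)))
           (λ a≡ → a≢c (trans (cong (σ ·_) a≡) (··⁻¹ σ c)))
           (λ b≡d → b≢d (·-injective (σ ⁻¹) b≡d))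

CycleCountAt : ∀ {n} → Graph n → ℕ → ℕ → Fin n → Set
CycleCountAt G g k u = ∀ {w} → E G u w → HasCount k (CycleThrough G g u w)

module _ {n : ℕ} {G : Graph n} where

  CycleCountAt-preserved : (σ : Automorphism G) → ∀ {g k u} →
                           CycleCountAt G g k u → CycleCountAt G g k (σ · u)
  CycleCountAt-preserved σ {g} {k} {u} count {w} euw =
    subst (λ x → HasCount k (CycleThrough G g (σ · u) x)) (··⁻¹ σ w)
      (cycleCount-preserved σ (count (E-pulled-back σ euw)))

  cycle-from-count : ∀ {g k u w} → HasCount (suc k) (CycleThrough G g u w) → HasCycleOfLength G g
  cycle-from-count (c ∷ _ , _ , _ , ∈⇔) = c , proj₁ (Equivalence.to (∈⇔ c) (here refl))

module _ {n : ℕ} (nbrs : Fin n → List (Fin n))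
         (symm : ∀ {i j} → j ∈ nbrs i → i ∈ nbrs j) (loopless : ∀ i → i ∉ nbrs i) where
  open import Data.List.Membership.DecPropositional (Fin._≟_ {n}) using (_∈?_)

  listGraph-automorphism : (π : Permutation′ n) → (∀ i → nbrs (π ⟨$⟩ʳ i) ≡ map (π ⟨$⟩ʳ_) (nbrs i)) →
                           Automorphism (listGraph nbrs symm loopless)
  listGraph-automorphism π equivariant = record
    { perm      = π
    ; preserves = λ i j → does-⇔ (mk⇔ (from i j) (to i j)) (π ⟨$⟩ʳ j ∈? nbrs (π ⟨$⟩ʳ i)) (j ∈? nbrs i)
    }
    where
    to : ∀ i j → j ∈ nbrs i → π ⟨$⟩ʳ j ∈ nbrs (π ⟨$⟩ʳ i)
    to i j j∈ = subst (π ⟨$⟩ʳ j ∈_) (sym (equivariant i)) (∈-map⁺ _ j∈)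
    from : ∀ i j → π ⟨$⟩ʳ j ∈ nbrs (π ⟨$⟩ʳ i) → j ∈ nbrs i
    from i j πj∈ with x , x∈ , πj≡πx ← ∈-map⁻ _ (subst (π ⟨$⟩ʳ j ∈_) (equivariant i) πj∈) =
      subst (_∈ nbrs i) (trans (sym (inverseˡ π)) (trans (cong (π ⟨$⟩ˡ_) (sym πj≡πx)) (inverseˡ π))) x∈

-- The graph G₄₂

baseNeighbours : Vec (List ℕ) 6
baseNeighbours =
    (9  ∷ 12 ∷ 23 ∷ 29 ∷ 30 ∷ 38 ∷ [])
  ∷ (11 ∷ 15 ∷ 19 ∷ 25 ∷ 32 ∷ 41 ∷ [])
  ∷ (6  ∷ 13 ∷ 21 ∷ 28 ∷ 33 ∷ 39 ∷ [])
  ∷ (8  ∷ 14 ∷ 22 ∷ 26 ∷ 31 ∷ 36 ∷ [])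
  ∷ (10 ∷ 17 ∷ 20 ∷ 27 ∷ 35 ∷ 40 ∷ [])
  ∷ (7  ∷ 16 ∷ 18 ∷ 24 ∷ 34 ∷ 37 ∷ [])
  ∷ []

nbrs₄₂ : Fin 42 → List (Fin 42)
nbrs₄₂ v = map (λ d → (d + 6 * (toℕ v / 6)) mod 42) (Vec.lookup baseNeighbours (toℕ v mod 6))

open import Data.List.Membership.DecPropositional (Fin._≟_ {42}) using (_∈?_)

symmetric₄₂ : ∀ {i j} → j ∈ nbrs₄₂ i → i ∈ nbrs₄₂ j
symmetric₄₂ {i} =
  All.lookup (toWitness {a? = Fin.all? λ i → All.all? (λ j → i ∈? nbrs₄₂ j) (nbrs₄₂ i)} tt i)

loopless₄₂ : ∀ i → i ∉ nbrs₄₂ i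
loopless₄₂ = toWitness {a? = Fin.all? λ i → ¬? (i ∈? nbrs₄₂ i)} tt

unique₄₂ : ∀ i → Unique (nbrs₄₂ i)
unique₄₂ = toWitness {a? = Fin.all? λ i → unique? Fin._≟_ (nbrs₄₂ i)} tt

G₄₂ : Graph 42
G₄₂ = listGraph nbrs₄₂ symmetric₄₂ loopless₄₂

L₄₂ : AdjacencyList G₄₂
L₄₂ = listAdjacencyList nbrs₄₂ symmetric₄₂ loopless₄₂ unique₄₂

open AdjacencyList L₄₂ using (nbrs-sound; nbrs-complete)
open FiveCycles L₄₂ using (fiveCyclesThrough; fiveCycleCount)

regular₄₂ : ∀ i → degree G₄₂ i ≡ 6
regular₄₂ i =
  trans (sym (length-nbrs L₄₂ i)) (toWitness {a? = Fin.all? λ i → length (nbrs₄₂ i) ℕ.≟ 6} tt i)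

rotate rotate⁻¹ : Fin 42 → Fin 42
rotate   v = (toℕ v + 6) mod 42
rotate⁻¹ v = (toℕ v + 36) mod 42

ρ : Automorphism G₄₂
ρ = listGraph-automorphism nbrs₄₂ symmetric₄₂ loopless₄₂
      (permutation rotate rotate⁻¹ (toWitness {a? = Fin.all? λ v → rotate (rotate⁻¹ v) Fin.≟ v} tt)
                                   (toWitness {a? = Fin.all? λ v → rotate⁻¹ (rotate v) Fin.≟ v} tt))
      (toWitness {a? = Fin.all? λ v → ≡-dec Fin._≟_ (nbrs₄₂ (rotate v)) (map rotate (nbrs₄₂ v))} tt)

rotation-induction : (P : Fin 42 → Set) → (∀ {v} → P v → P (ρ · v)) → (∀ r → P (r ↑ˡ 36)) → ∀ v → P v
rotation-induction P preserved base v = subst P (orbit v) (iterate (toℕ v / 6) (base (toℕ v mod 6)))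
  where
  rotations : ℕ → Fin 42 → Fin 42
  rotations zero    = id
  rotations (suc q) = rotate ∘ rotations q
  iterate : ∀ q {x} → P x → P (rotations q x)
  iterate zero    p = p
  iterate (suc q) p = preserved (iterate q p)
  orbit : ∀ v → rotations (toℕ v / 6) ((toℕ v mod 6) ↑ˡ 36) ≡ v
  orbit = toWitness {a? = Fin.all? λ v → rotations (toℕ v / 6) ((toℕ v mod 6) ↑ˡ 36) Fin.≟ v} tt

edgeRegular₄₂ : ∀ u → CycleCountAt G₄₂ 5 20 u
edgeRegular₄₂ = rotation-induction _ (CycleCountAt-preserved ρ) λ r {w} e →
  subst (λ k → HasCount k (CycleThrough G₄₂ 5 (r ↑ˡ 36) w))
        (All.lookup (counts r) {w} (nbrs-complete {r ↑ˡ 36} {w} e)) (fiveCycleCount {r ↑ˡ 36} {w} e)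
  where
  counts : ∀ r → All (λ w → length (fiveCyclesThrough (r ↑ˡ 36) w) ≡ 20) (nbrs₄₂ (r ↑ˡ 36))
  counts = toWitness {a? = Fin.all? λ r →
             All.all? (λ w → length (fiveCyclesThrough (r ↑ˡ 36) w) ℕ.≟ 20) (nbrs₄₂ (r ↑ˡ 36))} tt

girth₄₂ : HasGirth G₄₂ 5
girth₄₂ = girth5 G₄₂ pentagon (rotation-induction _ (TriangleFreeAt-preserved ρ) triangleFree)
                              (rotation-induction _ (SquareFreeAt-preserved ρ) squareFree)
  where
  pentagon : HasCycleOfLength G₄₂ 5
  pentagon = cycle-from-count (edgeRegular₄₂ zero {# 9} (nbrs-sound {zero} {# 9} (here refl)))
  triangleFree : ∀ r → TriangleFreeAt G₄₂ (r ↑ˡ 36)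
  triangleFree = toWitness {a? = Fin.all? λ r → triangleFreeAt? L₄₂ (r ↑ˡ 36)} tt
  squareFree : ∀ r → SquareFreeAt G₄₂ (r ↑ˡ 36)
  squareFree = toWitness {a? = Fin.all? λ r → squareFreeAt? L₄₂ (r ↑ˡ 36)} tt

connected₄₂ : Connected G₄₂
connected₄₂ = connected-via G₄₂ zero (rotation-induction (λ v → Reachable G₄₂ v zero) rotated base)
  where
  pathTo0 : ∀ v → T (is-just (findPath L₄₂ 3 v zero)) → Reachable G₄₂ v zero
  pathTo0 v = to-witness-T (findPath L₄₂ 3 v zero)
  rotated : ∀ {v} → Reachable G₄₂ v zero → Reachable G₄₂ (ρ · v) zero
  rotated r = Reachable-trans G₄₂ (Reachable-preserved ρ r) (pathTo0 (ρ · zero) tt)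
  near : ∀ r → T (is-just (findPath L₄₂ 3 (r ↑ˡ 36) zero))
  near = toWitness {a? = Fin.all? λ r → T? (is-just (findPath L₄₂ 3 (r ↑ˡ 36) zero))} tt
  base : ∀ r → Reachable G₄₂ (r ↑ˡ 36) zero
  base r = pathTo0 (r ↑ˡ 36) (near r)

egr₄₂ : IsEGR G₄₂ 6 5 20
egr₄₂ = record
  { regular   = regular₄₂
  ; connected = connected₄₂
  ; girth     = girth₄₂
  ; edgeReg   = λ u w → edgeRegular₄₂ u {w}
  }

mainTheorem8 : NEGR≡ 6 5 20 42
mainTheorem8 = (G₄₂ , egr₄₂) , λ w w<42 G egr →
  <⇒≱ w<42 (ℕ.+-cancelʳ-≤ 20 42 w (girth5-order-bound egr))
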